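{- Let $F$ be a forest, and let $S$, $G$, $w$ and $\beta$ be as described in the context. Then for every $x\in S$, $w(x)\geq\beta(x)$.
   Context: All graphs are finite, simple, undirected. For a graph $H$, $\mathcal{N}(H)$ is the null space of its adjacency matrix, viewed as the set of functions $z:V(H)\to\mathbb{R}$ with $\sum_{y\in N_H(x)}z(y)=0$ for all $x\in V(H)$. Let $F$ be a forest. $S$ is the set of vertices $x$ of $F$ such that $z(x)\neq 0$ for some $z\in\mathcal{N}(F)$. $G$ is the forest whose edges are the edges of $F$ having at least one endpoint in $S$ and whose vertices are the endpoints of those edges. $R=V(G)\setminus S$. $\mathcal{N}_S(G)$ is the set of vectors in $\mathcal{N}(G)$ that are zero at every vertex of $G$ not in $S$. For $x\in S$, $w(x)$ is the minimum number of nonzeros among vectors in $\mathcal{N}_S(G)$ that are nonzero at $x$. Each component of $G$ is rooted at some (arbitrarily chosen) vertex of $S$; $\kappa(x)$ denotes the set of children and $\pi(x)$ the parent of $x$ (every vertex of $R$ has at least one child). Define $\overline{\beta}:V(G)\to\mathbb{N}$ recursively by $\overline{\beta}(x)=\min_{c\in\kappa(x)}\overline{\beta}(c)$ if $x\in R$ and $\overline{\beta}(x)=1+\sum_{c\in\kappa(x)}\overline{\beta}(c)$ if $x\in S$. Define $\beta:V(G)\to\mathbb{N}$ recursively from the roots downward by $\beta(x)=\min\{\overline{\beta}(x),\,\beta(\pi(x))-\overline{\beta}(x)\}$ if $x\in R$ and $\beta(x)=\overline{\beta}(x)+\beta(\pi(x))$ if $x\in S$, where $\beta(\pi(x))$ is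 taken to be $0$ if $x$ has no parent.
   Formalization: The vectors of $\mathcal{N}(F)$ and $\mathcal{N}_S(G)$ take values in ℚ instead of ℝ. -}

module Defs where

open import Data.Nat using (ℕ; zero; suc; _+_; _≤_; _⊓_; _∸_)
open import Data.Fin using (Fin; zero; suc; inject₁; fromℕ) renaming (_≟_ to _≟ᶠ_)
open import Data.Rational using (ℚ; 0ℚ) renaming (_+_ to _+ℚ_; _≟_ to _≟ℚ_)
open import Data.Bool using (Bool; true; false; if_then_else_; _∧_; _∨_)
open import Data.Maybe using (Maybe; just; nothing)
open import Data.Product using (Σ; ∃; _×_; _,_)
open import Data.Sum using (_⊎_)
open import Relation.Nullary using (¬_; does)
open import Relation.Binary.PropositionalEquality using (_≡_)
open import Function.Definitions using (Injective)

Adj : ℕ → Set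
Adj n = Fin n → Fin n → Bool

∑ℚ : ∀ {n} → (Fin n → ℚ) → ℚ
∑ℚ {zero}  f = 0ℚ
∑ℚ {suc n} f = f zero +ℚ ∑ℚ (λ i → f (suc i))

∑ℕ : ∀ {n} → (Fin n → ℕ) → ℕ
∑ℕ {zero}  f = 0
∑ℕ {suc n} f = f zero + ∑ℕ (λ i → f (suc i))

anyFin : ∀ {n} → (Fin n → Bool) → Bool
anyFin {zero}  f = false
anyFin {suc n} f = f zero ∨ anyFin (λ i → f (suc i))

IsSimpleGraph : ∀ {n} → Adj n → Set
IsSimpleGraph adj = (∀ x → adj x x ≡ false) × (∀ x y → adj x y ≡ adj y x)

HasCycle : ∀ {n} → Adj n → Set
HasCycle {n} adj =
  Σ ℕ λ m → Σ (Fin (3 + m) → Fin n) λ v →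
    Injective _≡_ _≡_ v
    × (∀ (i : Fin (2 + m)) → adj (v (inject₁ i)) (v (suc i)) ≡ true)
    × adj (v (fromℕ (2 + m))) (v zero) ≡ true

IsForest : ∀ {n} → Adj n → Set
IsForest adj = IsSimpleGraph adj × ¬ HasCycle adj

InNull : ∀ {n} → Adj n → (Fin n → ℚ) → Set
InNull adj z = ∀ x → ∑ℚ (λ y → if adj x y then z y else 0ℚ) ≡ 0ℚ

IsSupportSet : ∀ {n} → Adj n → (Fin n → Bool) → Set
IsSupportSet adj inS =
  ∀ x → (inS x ≡ true → ∃ λ z → InNull adj z × ¬ z x ≡ 0ℚ)
        × ((∃ λ z → InNull adj z × ¬ z x ≡ 0ℚ) → inS x ≡ true)

adjG : ∀ {n} → Adj n → (Fin n → Bool) → Adj n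
adjG adj inS x y = adj x y ∧ (inS x ∨ inS y)

inV : ∀ {n} → Adj n → (Fin n → Bool) → Fin n → Bool
inV adj inS x = anyFin (adjG adj inS x)

-- z ∈ 𝒩_S(G): a function on V(G) (encoded as zero outside V(G)) in the null
-- space of G which vanishes at every vertex of G not in S
InNullS : ∀ {n} → Adj n → (Fin n → Bool) → (Fin n → ℚ) → Set
InNullS adj inS z =
  (∀ y → (inS y ∧ inV adj inS y) ≡ false → z y ≡ 0ℚ)
  × (∀ x → inV adj inS x ≡ true →
       ∑ℚ (λ y → if adjG adj inS x y then z y else 0ℚ) ≡ 0ℚ)

nnz : ∀ {n} → (Fin n → ℚ) → ℕ
nnz z = ∑ℕ (λ y → if does (z y ≟ℚ 0ℚ) then 0 else 1)

-- π is a rooting of G (parent function; nothing = root), each component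
-- rooted at a vertex of S
IsRooting : ∀ {n} → Adj n → (Fin n → Bool) → (Fin n → Maybe (Fin n)) → Set
IsRooting {n} adj inS π =
  (∀ x p → π x ≡ just p → adjG adj inS x p ≡ true)
  × (∀ x y → adjG adj inS x y ≡ true → (π x ≡ just y ⊎ π y ≡ just x))
  × (∀ x → inV adj inS x ≡ true → π x ≡ nothing → inS x ≡ true)
  × (Σ (Fin n → ℕ) λ d → ∀ x p → π x ≡ just p → d x ≡ suc (d p))

isChild : ∀ {n} → (Fin n → Maybe (Fin n)) → Fin n → Fin n → Bool
isChild π c x with π c
... | just p  = does (p ≟ᶠ x)
... | nothing = false

IsBetaBar : ∀ {n} → Adj n → (Fin n → Bool) → (Fin n → Maybe (Fin n)) → (Fin n → ℕ) → Set
IsBetaBar adj inS π βb =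
  ∀ x → inV adj inS x ≡ true →
    (inS x ≡ false →
       (∃ λ c → π c ≡ just x × βb x ≡ βb c)
       × (∀ c → π c ≡ just x → βb x ≤ βb c))
    × (inS x ≡ true →
       βb x ≡ suc (∑ℕ (λ c → if isChild π c x then βb c else 0)))

parentVal : ∀ {n} → (Fin n → Maybe (Fin n)) → (Fin n → ℕ) → Fin n → ℕ
parentVal π β x with π x
... | just p  = β p
... | nothing = 0

IsBeta : ∀ {n} → Adj n → (Fin n → Bool) → (Fin n → Maybe (Fin n)) → (Fin n → ℕ) → (Fin n → ℕ) → Set
IsBeta adj inS π βb β =
  ∀ x → inV adj inS x ≡ true →
    (inS x ≡ false → β x ≡ βb x ⊓ (parentVal π β x ∸ βb x))
    × (inS x ≡ true → β x ≡ βb x + parentVal π β x)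

-- In a rooted forest, a null vector z that is nonzero at c vanishes on all children of c (a
-- nonzero child would, by induction, have vanishing children, and the null condition at it would
-- force z c = 0), so the null condition at c makes z vanish at the parent of c as well; adding two
-- null vectors of F then shows that S is independent in G. Now fix z ∈ 𝒩_S(G) and let N v count
-- the nonzeros of z in the subtree of v. For every x with z x ≠ 0:
--  * β̄ x ≤ N x, by induction down the tree: each child c of x lies in R and, by the null condition
--    at c, has a nonzero child c′, so β̄ c ≤ β̄ c′ ≤ N c′ ≤ N c;
--  * N x + β (π x) ≤ nnz z, by induction up the tree: p = π x lies in R, so it has a parent q. If
--    z q = 0, the null condition at p gives a nonzero sibling c′ of x, and β p ≤ β̄ p ≤ β̄ c′ ≤ N c′
--    with N x + N c′ ≤ N p. If z q ≠ 0, then β p ≤ β q − β̄ p, and comparing β q = 1 + Σ β̄ c + β (π q)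
--    with N q = 1 + Σ N c termwise (β̄ c ≤ N c for c ≠ p, and N x ≤ N p) reduces the claim to the
--    one at q.
-- Hence β x = β̄ x + β (π x) ≤ N x + β (π x) ≤ nnz z.
module Submission where

open import Defs
open import Data.Nat using (ℕ; zero; suc; _+_; _*_; _≤_; _<_; _⊓_; _∸_; z≤n; s≤s; _≤?_) renaming (_≟_ to _≟ℕ_)
open import Data.Nat.Properties
open import Data.Fin using (Fin; zero; suc) renaming (_≟_ to _≟ᶠ_)
open import Data.Fin.Properties using (any?) renaming (suc-injective to Fin-suc-injective)
open import Data.Rational using (ℚ; 0ℚ) renaming (_+_ to _+ℚ_; _≟_ to _≟ℚ_)
import Data.Rational.Properties as ℚ
open import Data.Bool using (Bool; true; false; if_then_else_; _∧_; _∨_)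
open import Data.Maybe using (Maybe; just; nothing)
open import Data.Product using (∃; _×_; _,_; proj₁; proj₂)
open import Data.Sum using (_⊎_; inj₁; inj₂)
open import Data.Empty using (⊥; ⊥-elim)
open import Relation.Nullary using (¬_; Dec; does; yes; no)
open import Relation.Nullary.Decidable using (¬?; _×-dec_; decidable-stable; dec-true; dec-false; toSum)
open import Relation.Binary.PropositionalEquality
open import Relation.Binary.Construct.On using () renaming (wellFounded to on-wellFounded)
open import Induction.WellFounded using (module All)
open import Data.Nat.Induction using (<-wellFounded)
open import Data.Maybe.Properties using (just-injective)
open import Data.Bool.Properties
  using (if-float; if-eta; ⇔→≡; ∨-comm; ∨-zeroʳ; ∧-identityʳ; ∧-conicalˡ; ∧-conicalʳ; ¬-not)
open import Function.Bundles using (mk⇔)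
open import Function using (_∘_; case_of_)
open import Data.Nat.Tactic.RingSolver using (solve-∀)
open import Algebra.Bundles using (CommutativeMonoid)
open import Algebra.Properties.CommutativeSemigroup +-commutativeSemigroup
  using (xy∙z≈xz∙y) renaming (interchange to +-interchange)
open import Algebra.Properties.CommutativeSemigroup
  (CommutativeMonoid.commutativeSemigroup ℚ.+-0-commutativeMonoid)
  using () renaming (interchange to +ℚ-interchange)

∑ℕ-cong : ∀ {m} {f g : Fin m → ℕ} → (∀ i → f i ≡ g i) → ∑ℕ f ≡ ∑ℕ g
∑ℕ-cong {zero}  f≗g = refl
∑ℕ-cong {suc m} f≗g = cong₂ _+_ (f≗g zero) (∑ℕ-cong (f≗g ∘ suc))

∑ℕ-zero : ∀ {m} {f : Fin m → ℕ} → (∀ i → f i ≡ 0) → ∑ℕ f ≡ 0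
∑ℕ-zero {zero}  f≗0 = refl
∑ℕ-zero {suc m} f≗0 = cong₂ _+_ (f≗0 zero) (∑ℕ-zero (f≗0 ∘ suc))

∑ℕ-distrib-+ : ∀ {m} (f g : Fin m → ℕ) → ∑ℕ (λ i → f i + g i) ≡ ∑ℕ f + ∑ℕ g
∑ℕ-distrib-+ {zero}  f g = refl
∑ℕ-distrib-+ {suc m} f g =
  trans (cong (f zero + g zero +_) (∑ℕ-distrib-+ (f ∘ suc) (g ∘ suc)))
        (+-interchange (f zero) (g zero) _ _)

∑ℕ-distribʳ-* : ∀ {m} (f : Fin m → ℕ) k → ∑ℕ (λ i → f i * k) ≡ ∑ℕ f * k
∑ℕ-distribʳ-* {zero}  f k = refl
∑ℕ-distribʳ-* {suc m} f k =
  trans (cong (f zero * k +_) (∑ℕ-distribʳ-* (f ∘ suc) k))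
        (sym (*-distribʳ-+ k (f zero) _))

∑ℕ-comm : ∀ {m l} (f : Fin m → Fin l → ℕ) →
          ∑ℕ (λ i → ∑ℕ (f i)) ≡ ∑ℕ (λ j → ∑ℕ (λ i → f i j))
∑ℕ-comm {zero} {l} f = sym (∑ℕ-zero {l} (λ _ → refl))
∑ℕ-comm {suc m} f =
  trans (cong (∑ℕ (f zero) +_) (∑ℕ-comm (f ∘ suc)))
        (sym (∑ℕ-distrib-+ (f zero) (λ j → ∑ℕ (λ i → f (suc i) j))))

∑ℕ-single : ∀ {m} (f : Fin m → ℕ) a → (∀ i → i ≢ a → f i ≡ 0) → ∑ℕ f ≡ f a
∑ℕ-single f zero    f≗0 = trans (cong (f zero +_) (∑ℕ-zero (λ i → f≗0 (suc i) λ ()))) (+-identityʳ _)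
∑ℕ-single f (suc a) f≗0 =
  cong₂ _+_ (f≗0 zero λ ()) (∑ℕ-single (f ∘ suc) a (λ i i≢a → f≗0 (suc i) (i≢a ∘ Fin-suc-injective)))

∑ℕ-mono : ∀ {m} {f g : Fin m → ℕ} → (∀ i → f i ≤ g i) → ∑ℕ f ≤ ∑ℕ g
∑ℕ-mono {zero}  f≤g = z≤n
∑ℕ-mono {suc m} f≤g = +-mono-≤ (f≤g zero) (∑ℕ-mono (f≤g ∘ suc))

∑ℕ-mono-except : ∀ {m} {f g : Fin m → ℕ} a {k l} → (∀ i → i ≢ a → f i ≤ g i) →
                 f a + k ≤ g a + l → ∑ℕ f + k ≤ ∑ℕ g + l
∑ℕ-mono-except {f = f} {g} zero {k} {l} f≤g fk≤gl = begin
  f zero + ∑ℕ (f ∘ suc) + k   ≡⟨ xy∙z≈xz∙y (f zero) _ k ⟩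
  f zero + k + ∑ℕ (f ∘ suc)   ≤⟨ +-mono-≤ fk≤gl (∑ℕ-mono (λ i → f≤g (suc i) λ ())) ⟩
  g zero + l + ∑ℕ (g ∘ suc)   ≡⟨ xy∙z≈xz∙y (g zero) l _ ⟩
  g zero + ∑ℕ (g ∘ suc) + l   ∎
  where open ≤-Reasoning
∑ℕ-mono-except {f = f} {g} (suc a) {k} {l} f≤g fk≤gl = begin
  f zero + ∑ℕ (f ∘ suc) + k   ≡⟨ +-assoc (f zero) _ k ⟩
  f zero + (∑ℕ (f ∘ suc) + k) ≤⟨ +-mono-≤ (f≤g zero λ ()) (∑ℕ-mono-except a f∘suc≤g∘suc fk≤gl) ⟩
  g zero + (∑ℕ (g ∘ suc) + l) ≡⟨ +-assoc (g zero) _ l ⟨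
  g zero + ∑ℕ (g ∘ suc) + l   ∎
  where
  open ≤-Reasoning
  f∘suc≤g∘suc : ∀ i → i ≢ a → f (suc i) ≤ g (suc i)
  f∘suc≤g∘suc i i≢a = f≤g (suc i) (i≢a ∘ Fin-suc-injective)

∑ℕ-term≤ : ∀ {m} (f : Fin m → ℕ) a → f a ≤ ∑ℕ f
∑ℕ-term≤ f zero    = m≤m+n _ _
∑ℕ-term≤ f (suc a) = ≤-trans (∑ℕ-term≤ (f ∘ suc) a) (m≤n+m _ _)

∑ℕ-two-terms≤ : ∀ {m} (f : Fin m → ℕ) {a b} → a ≢ b → f a + f b ≤ ∑ℕ f
∑ℕ-two-terms≤ f {zero}  {zero}  a≢b = ⊥-elim (a≢b refl)
∑ℕ-two-terms≤ f {zero}  {suc b} a≢b = +-monoʳ-≤ (f zero) (∑ℕ-term≤ (f ∘ suc) b)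
∑ℕ-two-terms≤ f {suc a} {zero}  a≢b =
  subst (_≤ ∑ℕ f) (+-comm (f zero) (f (suc a))) (+-monoʳ-≤ (f zero) (∑ℕ-term≤ (f ∘ suc) a))
∑ℕ-two-terms≤ f {suc a} {suc b} a≢b =
  ≤-trans (∑ℕ-two-terms≤ (f ∘ suc) (a≢b ∘ cong suc)) (m≤n+m _ _)

δ : ∀ {m} → Fin m → Fin m → ℕ
δ i j = if does (i ≟ᶠ j) then 1 else 0

δ-refl : ∀ {m} (i : Fin m) → δ i i ≡ 1
δ-refl i = cong (λ b → if b then 1 else 0) (dec-true (i ≟ᶠ i) refl)

δ-≢ : ∀ {m} {i j : Fin m} → i ≢ j → δ i j ≡ 0
δ-≢ {i = i} {j} i≢j = cong (λ b → if b then 1 else 0) (dec-false (i ≟ᶠ j) i≢j)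

∑ℕ-δ : ∀ {m} (f : Fin m → ℕ) a → ∑ℕ (λ i → δ i a * f i) ≡ f a
∑ℕ-δ f a = begin
  ∑ℕ (λ i → δ i a * f i) ≡⟨ ∑ℕ-single _ a (λ i i≢a → cong (_* f i) (δ-≢ i≢a)) ⟩
  δ a a * f a            ≡⟨ cong (_* f a) (δ-refl a) ⟩
  1 * f a                ≡⟨ *-identityˡ (f a) ⟩
  f a                    ∎
  where open ≡-Reasoning

∑ℕ-if : ∀ {m} b (f : Fin m → ℕ) → ∑ℕ (λ i → if b then f i else 0) ≡ (if b then ∑ℕ f else 0)
∑ℕ-if true  f = refl
∑ℕ-if {m} false f = ∑ℕ-zero {m} (λ _ → refl)

if-distrib-+ : ∀ b (x y : ℕ) → (if b then x + y else 0) ≡ (if b then x else 0) + (if b then y else 0)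
if-distrib-+ true  x y = refl
if-distrib-+ false x y = refl

∑ℚ-cong : ∀ {m} {f g : Fin m → ℚ} → (∀ i → f i ≡ g i) → ∑ℚ f ≡ ∑ℚ g
∑ℚ-cong {zero}  f≗g = refl
∑ℚ-cong {suc m} f≗g = cong₂ _+ℚ_ (f≗g zero) (∑ℚ-cong (f≗g ∘ suc))

∑ℚ-zero : ∀ {m} {f : Fin m → ℚ} → (∀ i → f i ≡ 0ℚ) → ∑ℚ f ≡ 0ℚ
∑ℚ-zero {zero}  f≗0 = refl
∑ℚ-zero {suc m} f≗0 = trans (cong₂ _+ℚ_ (f≗0 zero) (∑ℚ-zero (f≗0 ∘ suc))) (ℚ.+-identityʳ 0ℚ)

∑ℚ-distrib-+ : ∀ {m} (f g : Fin m → ℚ) → ∑ℚ (λ i → f i +ℚ g i) ≡ ∑ℚ f +ℚ ∑ℚ g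
∑ℚ-distrib-+ {zero}  f g = sym (ℚ.+-identityʳ 0ℚ)
∑ℚ-distrib-+ {suc m} f g =
  trans (cong (f zero +ℚ g zero +ℚ_) (∑ℚ-distrib-+ (f ∘ suc) (g ∘ suc)))
        (+ℚ-interchange (f zero) (g zero) _ _)

∑ℚ-single : ∀ {m} (f : Fin m → ℚ) a → (∀ i → i ≢ a → f i ≡ 0ℚ) → ∑ℚ f ≡ f a
∑ℚ-single f zero    f≗0 = trans (cong (f zero +ℚ_) (∑ℚ-zero (λ i → f≗0 (suc i) λ ()))) (ℚ.+-identityʳ _)
∑ℚ-single f (suc a) f≗0 =
  trans (cong₂ _+ℚ_ (f≗0 zero λ ())
                    (∑ℚ-single (f ∘ suc) a (λ i i≢a → f≗0 (suc i) (i≢a ∘ Fin-suc-injective))))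
        (ℚ.+-identityˡ _)

∑ℚ-nonzero-term : ∀ {m} (f : Fin m → ℚ) → ∑ℚ f ≢ 0ℚ → ∃ λ i → f i ≢ 0ℚ
∑ℚ-nonzero-term f ∑f≢0 with any? (λ i → ¬? (f i ≟ℚ 0ℚ))
... | yes found = found
... | no none = ⊥-elim (∑f≢0 (∑ℚ-zero λ i → decidable-stable (f i ≟ℚ 0ℚ) (λ fi≢0 → none (i , fi≢0))))

∑ℚ-other-nonzero-term : ∀ {m} (f : Fin m → ℚ) a → ∑ℚ f ≡ 0ℚ → f a ≢ 0ℚ →
                        ∃ λ i → i ≢ a × f i ≢ 0ℚ
∑ℚ-other-nonzero-term f a ∑f≡0 fa≢0 with any? (λ i → ¬? (i ≟ᶠ a) ×-dec ¬? (f i ≟ℚ 0ℚ))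
... | yes found = found
... | no none = ⊥-elim (fa≢0 (trans (sym (∑ℚ-single f a others-vanish)) ∑f≡0))
  where
  others-vanish : ∀ i → i ≢ a → f i ≡ 0ℚ
  others-vanish i i≢a = decidable-stable (f i ≟ℚ 0ℚ) (λ fi≢0 → none (i , i≢a , fi≢0))

if-distrib-+ℚ : ∀ b (x y : ℚ) → (if b then x +ℚ y else 0ℚ) ≡ (if b then x else 0ℚ) +ℚ (if b then y else 0ℚ)
if-distrib-+ℚ true  x y = refl
if-distrib-+ℚ false x y = sym (ℚ.+-identityʳ 0ℚ)

if-∨-split : ∀ b c (x : ℚ) → (b ≡ true → c ≡ true → ⊥) →
             (if b ∨ c then x else 0ℚ) ≡ (if b then x else 0ℚ) +ℚ (if c then x else 0ℚ)
if-∨-split true  true  x b∧c = ⊥-elim (b∧c refl refl)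
if-∨-split true  false x _   = sym (ℚ.+-identityʳ x)
if-∨-split false true  x _   = sym (ℚ.+-identityˡ x)
if-∨-split false false x _   = sym (ℚ.+-identityʳ 0ℚ)

x+y≡0∧y≡0⇒x≡0 : ∀ {x y} → x +ℚ y ≡ 0ℚ → y ≡ 0ℚ → x ≡ 0ℚ
x+y≡0∧y≡0⇒x≡0 {x} x+y≡0 refl = trans (sym (ℚ.+-identityʳ x)) x+y≡0

x+y≡0∧x≡0⇒y≡0 : ∀ {x y} → x +ℚ y ≡ 0ℚ → x ≡ 0ℚ → y ≡ 0ℚ
x+y≡0∧x≡0⇒y≡0 {_} {y} x+y≡0 refl = trans (sym (ℚ.+-identityˡ y)) x+y≡0

m+n≤o+p∧m≤o⇒m+[n∸p]≤o : ∀ {m n o p} → m + n ≤ o + p → m ≤ o → m + (n ∸ p) ≤ o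
m+n≤o+p∧m≤o⇒m+[n∸p]≤o {m} {n} {o} {p} m+n≤o+p m≤o with p ≤? n
... | yes p≤n = begin
  m + (n ∸ p) ≡⟨ +-∸-assoc m p≤n ⟨
  m + n ∸ p   ≤⟨ ∸-monoˡ-≤ p m+n≤o+p ⟩
  o + p ∸ p   ≡⟨ m+n∸n≡m o p ⟩
  o           ∎
  where open ≤-Reasoning
... | no p≰n rewrite m≤n⇒m∸n≡0 (<⇒≤ (≰⇒> p≰n)) | +-identityʳ m = m≤o

measure-rec : {A : Set} (m : A → ℕ) (P : A → Set) →
              (∀ x → (∀ {y} → m y < m x → P y) → P x) → ∀ x → P x
measure-rec m P = All.wfRec (on-wellFounded m <-wellFounded) _ P

anyFin-true : ∀ {m} (f : Fin m → Bool) a → f a ≡ true → anyFin f ≡ true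
anyFin-true f zero    fa = cong (_∨ anyFin (f ∘ suc)) fa
anyFin-true f (suc a) fa = trans (cong (f zero ∨_) (anyFin-true (f ∘ suc) a fa)) (∨-zeroʳ (f zero))

InNull-+ : ∀ {n} {adj : Adj n} {z₁ z₂} → InNull adj z₁ → InNull adj z₂ → InNull adj (λ y → z₁ y +ℚ z₂ y)
InNull-+ {n} {adj} {z₁} {z₂} null₁ null₂ x = begin
  ∑ℚ (λ y → if adj x y then z₁ y +ℚ z₂ y else 0ℚ)
    ≡⟨ ∑ℚ-cong (λ y → if-distrib-+ℚ (adj x y) (z₁ y) (z₂ y)) ⟩
  ∑ℚ (λ y → (if adj x y then z₁ y else 0ℚ) +ℚ (if adj x y then z₂ y else 0ℚ))
    ≡⟨ ∑ℚ-distrib-+ {n} _ _ ⟩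
  ∑ℚ (λ y → if adj x y then z₁ y else 0ℚ) +ℚ ∑ℚ (λ y → if adj x y then z₂ y else 0ℚ)
    ≡⟨ cong₂ _+ℚ_ (null₁ x) (null₂ x) ⟩
  0ℚ +ℚ 0ℚ
    ≡⟨ ℚ.+-identityʳ 0ℚ ⟩
  0ℚ ∎
  where open ≡-Reasoning

module RootedForest {n : ℕ} (π : Fin n → Maybe (Fin n)) (depth : Fin n → ℕ)
                    (depth-parent : ∀ x p → π x ≡ just p → depth x ≡ suc (depth p)) where

  parent-depth< : ∀ {x p} → π x ≡ just p → depth p < depth x
  parent-depth< {x} {p} e = ≤-reflexive (sym (depth-parent x p e))

  isChild-of-parent : ∀ {c p} v → π c ≡ just p → isChild π c v ≡ does (p ≟ᶠ v)
  isChild-of-parent v e rewrite e = refl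

  isChild⇒parent : ∀ {c v} → isChild π c v ≡ true → π c ≡ just v
  isChild⇒parent {c} {v} h with π c
  isChild⇒parent ()  | nothing
  isChild⇒parent {v = v} h | just p with p ≟ᶠ v
  isChild⇒parent h  | just p | yes refl = refl
  isChild⇒parent () | just p | no _

  parent⇒isChild : ∀ {c v} → π c ≡ just v → isChild π c v ≡ true
  parent⇒isChild {v = v} e = trans (isChild-of-parent v e) (dec-true (v ≟ᶠ v) refl)

  parentVal-just : ∀ (g : Fin n → ℕ) {x p} → π x ≡ just p → parentVal π g x ≡ g p
  parentVal-just g e rewrite e = refl

  parentVal-nothing : ∀ (g : Fin n → ℕ) {x} → π x ≡ nothing → parentVal π g x ≡ 0
  parentVal-nothing g e rewrite e = refl

  -- inSubtree y v is 1 if v is y or one of its ancestors and 0 otherwise: the walk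
  -- y, π y, π (π y), … reaches a root within depth y steps.
  ancestorWalk : ℕ → Maybe (Fin n) → Fin n → ℕ
  ancestorWalk _       nothing  v = 0
  ancestorWalk zero    (just y) v = 0
  ancestorWalk (suc k) (just y) v = δ y v + ancestorWalk k (π y) v

  inSubtree : Fin n → Fin n → ℕ
  inSubtree y v = ancestorWalk (suc (depth y)) (just y) v

  inSubtree-parent : ∀ {y p} v → π y ≡ just p → inSubtree y v ≡ δ y v + inSubtree p v
  inSubtree-parent {y} {p} v e rewrite depth-parent y p e | e = refl

  inSubtree-root : ∀ {y} v → π y ≡ nothing → inSubtree y v ≡ δ y v + 0
  inSubtree-root v e rewrite e = refl

  root-or-parent : ∀ y → π y ≡ nothing ⊎ ∃ λ p → π y ≡ just p
  root-or-parent y with π y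
  ... | nothing = inj₁ refl
  ... | just p  = inj₂ (p , refl)

  depth-rec : (P : Fin n → Set) → (∀ x → (∀ {y} → depth y < depth x → P y) → P x) → ∀ x → P x
  depth-rec = measure-rec depth

  inSubtree⇒depth≤ : ∀ y v → inSubtree y v ≢ 0 → depth v ≤ depth y
  inSubtree⇒depth≤ = depth-rec (λ y → ∀ v → inSubtree y v ≢ 0 → depth v ≤ depth y) step
    where
    step : ∀ y → (∀ {p} → depth p < depth y → ∀ v → inSubtree p v ≢ 0 → depth v ≤ depth p) →
           ∀ v → inSubtree y v ≢ 0 → depth v ≤ depth y
    step y ih v y∈v with toSum (y ≟ᶠ v) | root-or-parent y
    ... | inj₁ refl | _            = ≤-refl
    ... | inj₂ y≢v  | inj₁ e       = ⊥-elim (y∈v (trans (inSubtree-root v e) (cong (_+ 0) (δ-≢ y≢v))))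
    ... | inj₂ y≢v  | inj₂ (p , e) =
      <⇒≤ (≤-<-trans (ih (parent-depth< e) v p∈v) (parent-depth< e))
      where
      p∈v : inSubtree p v ≢ 0
      p∈v p∉v = y∈v (trans (inSubtree-parent v e) (cong₂ _+_ (δ-≢ y≢v) p∉v))

  not-inSubtree-of-parent : ∀ {y p} → π y ≡ just p → inSubtree p y ≡ 0
  not-inSubtree-of-parent {y} {p} e =
    decidable-stable (inSubtree p y ≟ℕ 0) (λ p∋y → <⇒≱ (parent-depth< e) (inSubtree⇒depth≤ p y p∋y))

  inSubtree≤1 : ∀ y v → inSubtree y v ≤ 1
  inSubtree≤1 = depth-rec (λ y → ∀ v → inSubtree y v ≤ 1) step
    where
    step : ∀ y → (∀ {p} → depth p < depth y → ∀ v → inSubtree p v ≤ 1) → ∀ v → inSubtree y v ≤ 1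
    step y ih v with toSum (y ≟ᶠ v) | root-or-parent y
    ... | inj₁ refl | inj₁ e       = ≤-reflexive (trans (inSubtree-root y e) (cong (_+ 0) (δ-refl y)))
    ... | inj₂ y≢v  | inj₁ e       =
      ≤-trans (≤-reflexive (trans (inSubtree-root v e) (cong (_+ 0) (δ-≢ y≢v)))) z≤n
    ... | inj₁ refl | inj₂ (p , e) =
      ≤-reflexive (trans (inSubtree-parent y e) (cong₂ _+_ (δ-refl y) (not-inSubtree-of-parent e)))
    ... | inj₂ y≢v  | inj₂ (p , e) =
      ≤-trans (≤-reflexive (trans (inSubtree-parent v e) (cong (_+ _) (δ-≢ y≢v)))) (ih (parent-depth< e) v)

  childSumℕ : (Fin n → ℕ) → Fin n → ℕ
  childSumℕ g v = ∑ℕ (λ c → if isChild π c v then g c else 0)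

  childSumℕ-distrib-+ : ∀ {g h} v → childSumℕ (λ c → g c + h c) v ≡ childSumℕ g v + childSumℕ h v
  childSumℕ-distrib-+ {g} {h} v =
    trans (∑ℕ-cong λ c → if-distrib-+ (isChild π c v) (g c) (h c)) (∑ℕ-distrib-+ {n} _ _)

  childSumℕ-δ : ∀ {y p} v → π y ≡ just p → childSumℕ (δ y) v ≡ δ p v
  childSumℕ-δ {y} {p} v e = trans (∑ℕ-single _ y others-vanish) at-y
    where
    others-vanish : ∀ c → c ≢ y → (if isChild π c v then δ y c else 0) ≡ 0
    others-vanish c c≢y with isChild π c v
    ... | true  = δ-≢ (c≢y ∘ sym)
    ... | false = refl
    at-y : (if isChild π y v then δ y y else 0) ≡ δ p v
    at-y rewrite isChild-of-parent v e | δ-refl y = refl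

  inSubtree-unfold : ∀ y v → inSubtree y v ≡ δ y v + childSumℕ (inSubtree y) v
  inSubtree-unfold = depth-rec (λ y → ∀ v → inSubtree y v ≡ δ y v + childSumℕ (inSubtree y) v) step
    where
    step : ∀ y → (∀ {p} → depth p < depth y → ∀ v → inSubtree p v ≡ δ p v + childSumℕ (inSubtree p) v) →
           ∀ v → inSubtree y v ≡ δ y v + childSumℕ (inSubtree y) v
    step y ih v with root-or-parent y
    ... | inj₁ root = trans (inSubtree-root v root) (cong (δ y v +_) (sym (∑ℕ-zero no-child-contains-y)))
      where
      no-child-contains-y : ∀ c → (if isChild π c v then inSubtree y c else 0) ≡ 0
      no-child-contains-y c with isChild π c v in c◃v
      ... | false = refl
      ... | true  = trans (inSubtree-root c root) (cong (_+ 0) (δ-≢ y≢c))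
        where
        y≢c : y ≢ c
        y≢c refl = case trans (sym root) (isChild⇒parent c◃v) of λ ()
    ... | inj₂ (p , e) = begin
      inSubtree y v                                            ≡⟨ inSubtree-parent v e ⟩
      δ y v + inSubtree p v                                    ≡⟨ cong (δ y v +_) (ih (parent-depth< e) v) ⟩
      δ y v + (δ p v + childSumℕ (inSubtree p) v)              ≡⟨ cong (λ k → δ y v + (k + _)) (childSumℕ-δ v e) ⟨
      δ y v + (childSumℕ (δ y) v + childSumℕ (inSubtree p) v)  ≡⟨ cong (δ y v +_) (childSumℕ-distrib-+ v) ⟨
      δ y v + childSumℕ (λ c → δ y c + inSubtree p c) v        ≡⟨ cong (δ y v +_) (∑ℕ-cong via-parent) ⟨
      δ y v + childSumℕ (inSubtree y) v                        ∎
      where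
      open ≡-Reasoning
      via-parent : ∀ c → (if isChild π c v then inSubtree y c else 0)
                       ≡ (if isChild π c v then δ y c + inSubtree p c else 0)
      via-parent c = cong (λ k → if isChild π c v then k else 0) (inSubtree-parent c e)

  subtreeSum : (Fin n → ℕ) → Fin n → ℕ
  subtreeSum f v = ∑ℕ (λ y → inSubtree y v * f y)

  subtreeSum-unfold : ∀ f v → subtreeSum f v ≡ f v + childSumℕ (subtreeSum f) v
  subtreeSum-unfold f v = begin
    ∑ℕ (λ y → inSubtree y v * f y)
      ≡⟨ ∑ℕ-cong (λ y → trans (cong (_* f y) (inSubtree-unfold y v)) (*-distribʳ-+ (f y) (δ y v) _)) ⟩
    ∑ℕ (λ y → δ y v * f y + childSumℕ (inSubtree y) v * f y)
      ≡⟨ ∑ℕ-distrib-+ {n} _ _ ⟩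
    ∑ℕ (λ y → δ y v * f y) + ∑ℕ (λ y → childSumℕ (inSubtree y) v * f y)
      ≡⟨ cong₂ _+_ (∑ℕ-δ f v) (∑ℕ-cong λ y → sym (∑ℕ-distribʳ-* {n} _ (f y))) ⟩
    f v + ∑ℕ (λ y → ∑ℕ (λ c → (if isChild π c v then inSubtree y c else 0) * f y))
      ≡⟨ cong (f v +_) (∑ℕ-cong λ y → ∑ℕ-cong λ c → if-float (_* f y) (isChild π c v)) ⟩
    f v + ∑ℕ (λ y → ∑ℕ (λ c → if isChild π c v then inSubtree y c * f y else 0))
      ≡⟨ cong (f v +_) (∑ℕ-comm {n} {n} _) ⟩
    f v + ∑ℕ (λ c → ∑ℕ (λ y → if isChild π c v then inSubtree y c * f y else 0))
      ≡⟨ cong (f v +_) (∑ℕ-cong λ c → ∑ℕ-if {n} (isChild π c v) _) ⟩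
    f v + childSumℕ (subtreeSum f) v ∎
    where open ≡-Reasoning

  subtreeSum≤∑ : ∀ f v → subtreeSum f v ≤ ∑ℕ f
  subtreeSum≤∑ f v = ∑ℕ-mono λ y →
    ≤-trans (*-monoˡ-≤ (f y) (inSubtree≤1 y v)) (≤-reflexive (*-identityˡ (f y)))

  child-term : ∀ {A : Set} (g : Fin n → A) {c v} (a : A) → π c ≡ just v →
               (if isChild π c v then g c else a) ≡ g c
  child-term g a e = cong (λ b → if b then g _ else a) (parent⇒isChild e)

  childSumℕ-term≤ : ∀ g {c v} → π c ≡ just v → g c ≤ childSumℕ g v
  childSumℕ-term≤ g {c} {v} e =
    subst (_≤ childSumℕ g v) (child-term g 0 e) (∑ℕ-term≤ (λ c' → if isChild π c' v then g c' else 0) c)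

  childSumℕ-two-terms≤ : ∀ g {a b p} → π a ≡ just p → π b ≡ just p → a ≢ b →
                         g a + g b ≤ childSumℕ g p
  childSumℕ-two-terms≤ g {p = p} ea eb a≢b =
    subst₂ (λ x y → x + y ≤ childSumℕ g p) (child-term g 0 ea) (child-term g 0 eb)
           (∑ℕ-two-terms≤ (λ c → if isChild π c p then g c else 0) a≢b)

  child-terms≤ : ∀ {g h : Fin n → ℕ} v c → (π c ≡ just v → g c ≤ h c) →
                 (if isChild π c v then g c else 0) ≤ (if isChild π c v then h c else 0)
  child-terms≤ v c g≤h with isChild π c v in c◃v
  ... | true  = g≤h (isChild⇒parent c◃v)
  ... | false = z≤n

  childSumℕ-mono : ∀ {g h : Fin n → ℕ} v → (∀ c → π c ≡ just v → g c ≤ h c) → childSumℕ g v ≤ childSumℕ h v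
  childSumℕ-mono {g} {h} v g≤h = ∑ℕ-mono λ c → child-terms≤ {g} {h} v c (g≤h c)

  childSumℕ-mono-except : ∀ {g h : Fin n → ℕ} {a v k l} → π a ≡ just v →
                          (∀ c → c ≢ a → π c ≡ just v → g c ≤ h c) →
                          g a + k ≤ h a + l → childSumℕ g v + k ≤ childSumℕ h v + l
  childSumℕ-mono-except {g} {h} {a} {k = k} {l} e g≤h ga+k≤ha+l =
    ∑ℕ-mono-except a (λ c c≢a → child-terms≤ {g} {h} _ c (g≤h c c≢a))
      (subst₂ (λ x y → x + k ≤ y + l) (sym (child-term g 0 e)) (sym (child-term h 0 e)) ga+k≤ha+l)

  subtreeSum-child≤ : ∀ f {c v} → π c ≡ just v → subtreeSum f c ≤ subtreeSum f v
  subtreeSum-child≤ f {v = v} e = begin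
    subtreeSum f _                    ≤⟨ childSumℕ-term≤ (subtreeSum f) e ⟩
    childSumℕ (subtreeSum f) v        ≤⟨ m≤n+m _ (f v) ⟩
    f v + childSumℕ (subtreeSum f) v  ≡⟨ subtreeSum-unfold f v ⟨
    subtreeSum f v                    ∎
    where open ≤-Reasoning

  subtreeSum-siblings≤ : ∀ f {a b p} → π a ≡ just p → π b ≡ just p → a ≢ b →
                         subtreeSum f a + subtreeSum f b ≤ subtreeSum f p
  subtreeSum-siblings≤ f {p = p} ea eb a≢b = begin
    subtreeSum f _ + subtreeSum f _   ≤⟨ childSumℕ-two-terms≤ (subtreeSum f) ea eb a≢b ⟩
    childSumℕ (subtreeSum f) p        ≤⟨ m≤n+m _ (f p) ⟩
    f p + childSumℕ (subtreeSum f) p  ≡⟨ subtreeSum-unfold f p ⟨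
    subtreeSum f p                    ∎
    where open ≤-Reasoning

  subtreeSize : Fin n → ℕ
  subtreeSize = subtreeSum (λ _ → 1)

  subtreeSize-child< : ∀ {c v} → π c ≡ just v → subtreeSize c < subtreeSize v
  subtreeSize-child< {v = v} e =
    subst (_ <_) (sym (subtreeSum-unfold _ v)) (s≤s (childSumℕ-term≤ subtreeSize e))

  subtree-rec : (P : Fin n → Set) →
                (∀ x → (∀ {y} → subtreeSize y < subtreeSize x → P y) → P x) → ∀ x → P x
  subtree-rec = measure-rec subtreeSize

  childSumℚ : (Fin n → ℚ) → Fin n → ℚ
  childSumℚ z v = ∑ℚ (λ c → if isChild π c v then z c else 0ℚ)

  nonzero-child-term : ∀ (z : Fin n → ℚ) {c v} → (if isChild π c v then z c else 0ℚ) ≢ 0ℚ →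
                       π c ≡ just v × z c ≢ 0ℚ
  nonzero-child-term z {c} {v} term≢0 with isChild π c v in c◃v
  ... | true  = isChild⇒parent c◃v , term≢0
  ... | false = ⊥-elim (term≢0 refl)

  childSumℚ-nonzero : ∀ z {v} → childSumℚ z v ≢ 0ℚ → ∃ λ c → π c ≡ just v × z c ≢ 0ℚ
  childSumℚ-nonzero z ∑≢0 with ∑ℚ-nonzero-term _ ∑≢0
  ... | c , term≢0 = c , nonzero-child-term z term≢0

  childSumℚ-other-nonzero : ∀ z {x p} → childSumℚ z p ≡ 0ℚ → π x ≡ just p → z x ≢ 0ℚ →
                            ∃ λ c → c ≢ x × π c ≡ just p × z c ≢ 0ℚ
  childSumℚ-other-nonzero z ∑≡0 e zx≢0
    with ∑ℚ-other-nonzero-term _ _ ∑≡0 (λ term≡0 → zx≢0 (trans (sym (child-term z 0ℚ e)) term≡0))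
  ... | c , c≢x , term≢0 = c , c≢x , nonzero-child-term z term≢0

  childSumℚ-zero : ∀ z {v} → (∀ c → π c ≡ just v → z c ≡ 0ℚ) → childSumℚ z v ≡ 0ℚ
  childSumℚ-zero z {v} children≡0 = ∑ℚ-zero pointwise
    where
    pointwise : ∀ c → (if isChild π c v then z c else 0ℚ) ≡ 0ℚ
    pointwise c with isChild π c v in c◃v
    ... | true  = children≡0 c (isChild⇒parent c◃v)
    ... | false = refl

  parentSumℚ : ∀ (z : Fin n → ℚ) {w p} → π w ≡ just p →
               ∑ℚ (λ y → if isChild π w y then z y else 0ℚ) ≡ z p
  parentSumℚ z {w} {p} e = trans (∑ℚ-single _ p others-vanish) (child-term (λ _ → z p) 0ℚ e)
    where
    others-vanish : ∀ y → y ≢ p → (if isChild π w y then z y else 0ℚ) ≡ 0ℚ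
    others-vanish y y≢p with isChild π w y in w◃y
    ... | true  = ⊥-elim (y≢p (just-injective (trans (sym (isChild⇒parent w◃y)) e)))
    ... | false = refl

module ForestGraph {n : ℕ} (adj : Adj n) (adj-sym : ∀ x y → adj x y ≡ adj y x)
                   (inS : Fin n → Bool) (π : Fin n → Maybe (Fin n))
                   (parent-edge : ∀ x p → π x ≡ just p → adjG adj inS x p ≡ true)
                   (edge-parent : ∀ x y → adjG adj inS x y ≡ true → π x ≡ just y ⊎ π y ≡ just x)
                   (depth : Fin n → ℕ)
                   (depth-parent : ∀ x p → π x ≡ just p → depth x ≡ suc (depth p)) where

  open RootedForest π depth depth-parent public

  adjG-sym : ∀ x y → adjG adj inS x y ≡ adjG adj inS y x
  adjG-sym x y rewrite adj-sym x y | ∨-comm (inS x) (inS y) = refl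

  child∈V : ∀ {c v} → π c ≡ just v → inV adj inS c ≡ true
  child∈V {c} {v} e = anyFin-true (adjG adj inS c) v (parent-edge c v e)

  parent∈V : ∀ {c v} → π c ≡ just v → inV adj inS v ≡ true
  parent∈V {c} {v} e = anyFin-true (adjG adj inS v) c (trans (adjG-sym v c) (parent-edge c v e))

  adjG≡parent∨child : ∀ w y → adjG adj inS w y ≡ isChild π w y ∨ isChild π y w
  adjG≡parent∨child w y = ⇔→≡ (mk⇔ to from)
    where
    to : adjG adj inS w y ≡ true → (isChild π w y ∨ isChild π y w) ≡ true
    to w~y with edge-parent w y w~y
    ... | inj₁ e = cong (_∨ isChild π y w) (parent⇒isChild e)
    ... | inj₂ e = trans (cong (isChild π w y ∨_) (parent⇒isChild e)) (∨-zeroʳ _)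
    from : (isChild π w y ∨ isChild π y w) ≡ true → adjG adj inS w y ≡ true
    from h with isChild π w y in w◃y
    ... | true  = parent-edge w y (isChild⇒parent w◃y)
    ... | false = trans (adjG-sym w y) (parent-edge y w (isChild⇒parent h))

  not-mutual-parents : ∀ {w y} → π w ≡ just y → π y ≡ just w → ⊥
  not-mutual-parents e₁ e₂ = <-asym (parent-depth< e₁) (parent-depth< e₂)

  neighbourSum-split : ∀ (z : Fin n → ℚ) {w p} → π w ≡ just p →
                       ∑ℚ (λ y → if adjG adj inS w y then z y else 0ℚ) ≡ z p +ℚ childSumℚ z w
  neighbourSum-split z {w} {p} e = begin
    ∑ℚ (λ y → if adjG adj inS w y then z y else 0ℚ)
      ≡⟨ ∑ℚ-cong split ⟩
    ∑ℚ (λ y → (if isChild π w y then z y else 0ℚ) +ℚ (if isChild π y w then z y else 0ℚ))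
      ≡⟨ ∑ℚ-distrib-+ {n} _ _ ⟩
    ∑ℚ (λ y → if isChild π w y then z y else 0ℚ) +ℚ childSumℚ z w
      ≡⟨ cong (_+ℚ childSumℚ z w) (parentSumℚ z e) ⟩
    z p +ℚ childSumℚ z w ∎
    where
    open ≡-Reasoning
    split : ∀ y → (if adjG adj inS w y then z y else 0ℚ)
                ≡ (if isChild π w y then z y else 0ℚ) +ℚ (if isChild π y w then z y else 0ℚ)
    split y = trans (cong (λ b → if b then z y else 0ℚ) (adjG≡parent∨child w y))
                    (if-∨-split _ _ (z y) λ w◃y y◃w →
                       not-mutual-parents (isChild⇒parent w◃y) (isChild⇒parent y◃w))

  InNullG : (Fin n → ℚ) → Set
  InNullG z = ∀ x → inV adj inS x ≡ true → ∑ℚ (λ y → if adjG adj inS x y then z y else 0ℚ) ≡ 0ℚ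

  null-at-child : ∀ {z} → InNullG z → ∀ {c p} → π c ≡ just p → z p +ℚ childSumℚ z c ≡ 0ℚ
  null-at-child {z} null e = trans (sym (neighbourSum-split z e)) (null _ (child∈V e))

  children-of-nonzero-vanish : ∀ {z} → InNullG z → ∀ v → z v ≢ 0ℚ → ∀ c → π c ≡ just v → z c ≡ 0ℚ
  children-of-nonzero-vanish {z} null =
    subtree-rec (λ v → z v ≢ 0ℚ → ∀ c → π c ≡ just v → z c ≡ 0ℚ) step
    where
    step : ∀ v → (∀ {c} → subtreeSize c < subtreeSize v → z c ≢ 0ℚ → ∀ d → π d ≡ just c → z d ≡ 0ℚ) →
           z v ≢ 0ℚ → ∀ c → π c ≡ just v → z c ≡ 0ℚ
    step v ih zv≢0 c e = decidable-stable (z c ≟ℚ 0ℚ) λ zc≢0 →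
      zv≢0 (x+y≡0∧y≡0⇒x≡0 (null-at-child null e)
                          (childSumℚ-zero z (ih (subtreeSize-child< e) zc≢0)))

  parent-of-nonzero-vanishes : ∀ {z} → InNullG z → ∀ {c v} → π c ≡ just v → z c ≢ 0ℚ → z v ≡ 0ℚ
  parent-of-nonzero-vanishes {z} null {c} e zc≢0 =
    x+y≡0∧y≡0⇒x≡0 (null-at-child null e) (childSumℚ-zero z (children-of-nonzero-vanish null c zc≢0))

  adjG-into-S : ∀ x {y} → inS y ≡ true → adjG adj inS x y ≡ adj x y
  adjG-into-S x {y} y∈S rewrite y∈S | ∨-zeroʳ (inS x) = ∧-identityʳ (adj x y)

  module _ (support : IsSupportSet adj inS) where

    InNull⇒InNullG : ∀ {z} → InNull adj z → InNullG z
    InNull⇒InNullG {z} null x _ = trans (∑ℚ-cong same-term) (null x)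
      where
      -- z vanishes off S, so the F-edges missing from G contribute nothing.
      same-term : ∀ y → (if adjG adj inS x y then z y else 0ℚ) ≡ (if adj x y then z y else 0ℚ)
      same-term y with z y ≟ℚ 0ℚ
      ... | yes zy≡0 rewrite zy≡0 = trans (if-eta (adjG adj inS x y)) (sym (if-eta (adj x y)))
      ... | no zy≢0 =
        cong (λ b → if b then z y else 0ℚ) (adjG-into-S x (proj₂ (support y) (z , null , zy≢0)))

    S-independent : ∀ {c v} → π c ≡ just v → inS c ≡ true → inS v ≡ true → ⊥
    S-independent {c} {v} e c∈S v∈S with proj₁ (support v) v∈S | proj₁ (support c) c∈S
    -- z₁ + z₂ is a null vector of F that is nonzero at both c and its parent v.
    ... | z₁ , null₁ , z₁v≢0 | z₂ , null₂ , z₂c≢0 =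
      zv≢0 (parent-of-nonzero-vanishes (InNull⇒InNullG (InNull-+ {adj = adj} null₁ null₂)) e zc≢0)
      where
      z₁c≡0 : z₁ c ≡ 0ℚ
      z₁c≡0 = decidable-stable (z₁ c ≟ℚ 0ℚ)
                (λ z₁c≢0 → z₁v≢0 (parent-of-nonzero-vanishes (InNull⇒InNullG null₁) e z₁c≢0))
      z₂v≡0 : z₂ v ≡ 0ℚ
      z₂v≡0 = parent-of-nonzero-vanishes (InNull⇒InNullG null₂) e z₂c≢0
      zc≢0 : z₁ c +ℚ z₂ c ≢ 0ℚ
      zc≢0 zc≡0 = z₂c≢0 (x+y≡0∧x≡0⇒y≡0 zc≡0 z₁c≡0)
      zv≢0 : z₁ v +ℚ z₂ v ≢ 0ℚ
      zv≢0 zv≡0 = z₁v≢0 (x+y≡0∧y≡0⇒x≡0 zv≡0 z₂v≡0)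

module Bounds {n : ℕ} (adj : Adj n) (adj-sym : ∀ x y → adj x y ≡ adj y x)
              (inS : Fin n → Bool) (support : IsSupportSet adj inS) (π : Fin n → Maybe (Fin n))
              (parent-edge : ∀ x p → π x ≡ just p → adjG adj inS x p ≡ true)
              (edge-parent : ∀ x y → adjG adj inS x y ≡ true → π x ≡ just y ⊎ π y ≡ just x)
              (root∈S : ∀ x → inV adj inS x ≡ true → π x ≡ nothing → inS x ≡ true)
              (depth : Fin n → ℕ) (depth-parent : ∀ x p → π x ≡ just p → depth x ≡ suc (depth p))
              (βb β : Fin n → ℕ) (βb-rec : IsBetaBar adj inS π βb) (β-rec : IsBeta adj inS π βb β)
              (z : Fin n → ℚ) (z∈𝒩S : InNullS adj inS z) where

  open ForestGraph adj adj-sym inS π parent-edge edge-parent depth depth-parent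

  nonzero : Fin n → ℕ
  nonzero y = if does (z y ≟ℚ 0ℚ) then 0 else 1

  nnzSubtree : Fin n → ℕ
  nnzSubtree = subtreeSum nonzero

  nnzSubtree≤nnz : ∀ v → nnzSubtree v ≤ nnz z
  nnzSubtree≤nnz = subtreeSum≤∑ nonzero

  nnzSubtree-unfold : ∀ {v} → z v ≢ 0ℚ → nnzSubtree v ≡ suc (childSumℕ nnzSubtree v)
  nnzSubtree-unfold {v} zv≢0 =
    trans (subtreeSum-unfold nonzero v)
          (cong (λ b → (if b then 0 else 1) + childSumℕ nnzSubtree v) (dec-false (z v ≟ℚ 0ℚ) zv≢0))

  support⊆S∩V : ∀ {y} → z y ≢ 0ℚ → (inS y ∧ inV adj inS y) ≡ true
  support⊆S∩V {y} zy≢0 = ¬-not (zy≢0 ∘ proj₁ z∈𝒩S y)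

  support⊆S : ∀ {y} → z y ≢ 0ℚ → inS y ≡ true
  support⊆S zy≢0 = ∧-conicalˡ _ _ (support⊆S∩V zy≢0)

  support⊆V : ∀ {y} → z y ≢ 0ℚ → inV adj inS y ≡ true
  support⊆V zy≢0 = ∧-conicalʳ _ _ (support⊆S∩V zy≢0)

  βb-S : ∀ {v} → inV adj inS v ≡ true → inS v ≡ true → βb v ≡ suc (childSumℕ βb v)
  βb-S {v} v∈V = proj₂ (βb-rec v v∈V)

  βb-R≤child : ∀ {c d} → inS c ≡ false → π d ≡ just c → βb c ≤ βb d
  βb-R≤child {c} {d} c∉S e = proj₂ (proj₁ (βb-rec c (parent∈V e)) c∉S) d e

  β-S : ∀ {v} → inV adj inS v ≡ true → inS v ≡ true → β v ≡ βb v + parentVal π β v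
  β-S {v} v∈V = proj₂ (β-rec v v∈V)

  β-R : ∀ {v} → inV adj inS v ≡ true → inS v ≡ false → β v ≡ βb v ⊓ (parentVal π β v ∸ βb v)
  β-R {v} v∈V = proj₁ (β-rec v v∈V)

  child-of-nonzero : ∀ {c v} → π c ≡ just v → z v ≢ 0ℚ →
                     ∃ λ d → π d ≡ just c × z d ≢ 0ℚ × βb c ≤ βb d
  child-of-nonzero e zv≢0
    with childSumℚ-nonzero z (zv≢0 ∘ x+y≡0∧y≡0⇒x≡0 (null-at-child (proj₂ z∈𝒩S) e))
  ... | d , e′ , zd≢0 =
    d , e′ , zd≢0 , βb-R≤child (¬-not (λ c∈S → S-independent support e c∈S (support⊆S zv≢0))) e′

  βb≤nnzSubtree : ∀ v → z v ≢ 0ℚ → βb v ≤ nnzSubtree v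
  βb≤nnzSubtree = subtree-rec (λ v → z v ≢ 0ℚ → βb v ≤ nnzSubtree v) step
    where
    step : ∀ v → (∀ {d} → subtreeSize d < subtreeSize v → z d ≢ 0ℚ → βb d ≤ nnzSubtree d) →
           z v ≢ 0ℚ → βb v ≤ nnzSubtree v
    step v ih zv≢0 = begin
      βb v                          ≡⟨ βb-S (support⊆V zv≢0) (support⊆S zv≢0) ⟩
      suc (childSumℕ βb v)          ≤⟨ s≤s (childSumℕ-mono v child-bound) ⟩
      suc (childSumℕ nnzSubtree v)  ≡⟨ nnzSubtree-unfold zv≢0 ⟨
      nnzSubtree v                  ∎
      where
      open ≤-Reasoning
      child-bound : ∀ c → π c ≡ just v → βb c ≤ nnzSubtree c
      child-bound c e with child-of-nonzero e zv≢0
      ... | d , e′ , zd≢0 , βbc≤βbd =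
        ≤-trans βbc≤βbd (≤-trans (ih (<-trans (subtreeSize-child< e′) (subtreeSize-child< e)) zd≢0)
                                 (subtreeSum-child≤ nonzero e′))

  βb≤nnzSubtree-child : ∀ {c v} → π c ≡ just v → z v ≢ 0ℚ → βb c ≤ nnzSubtree c
  βb≤nnzSubtree-child e zv≢0 with child-of-nonzero e zv≢0
  ... | d , e′ , zd≢0 , βbc≤βbd =
    ≤-trans βbc≤βbd (≤-trans (βb≤nnzSubtree d zd≢0) (subtreeSum-child≤ nonzero e′))

  parent-of-support : ∀ {x p} → π x ≡ just p → z x ≢ 0ℚ →
                      inS p ≡ false × ∃ λ q → π p ≡ just q × β p ≡ βb p ⊓ (β q ∸ βb p)
  parent-of-support {x} {p} e zx≢0 with root-or-parent p
  ... | inj₁ root   = ⊥-elim (S-independent support e (support⊆S zx≢0) (root∈S p (parent∈V e) root))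
  ... | inj₂ (q , e′) =
    p∉S , q , e′ , trans (β-R (parent∈V e) p∉S) (cong (λ t → βb p ⊓ (t ∸ βb p)) (parentVal-just β e′))
    where
    p∉S : inS p ≡ false
    p∉S = ¬-not (S-independent support e (support⊆S zx≢0))

  bound-via-sibling : ∀ {x p q} → π x ≡ just p → π p ≡ just q → inS p ≡ false → z q ≡ 0ℚ → z x ≢ 0ℚ →
                      nnzSubtree x + βb p ≤ nnz z
  bound-via-sibling {x} {p} e e′ p∉S zq≡0 zx≢0
    with childSumℚ-other-nonzero z (x+y≡0∧x≡0⇒y≡0 (null-at-child (proj₂ z∈𝒩S) e′) zq≡0) e zx≢0
  ... | c , c≢x , ec , zc≢0 = begin
    nnzSubtree x + βb p          ≤⟨ +-monoʳ-≤ (nnzSubtree x) (βb-R≤child p∉S ec) ⟩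
    nnzSubtree x + βb c          ≤⟨ +-monoʳ-≤ (nnzSubtree x) (βb≤nnzSubtree c zc≢0) ⟩
    nnzSubtree x + nnzSubtree c  ≤⟨ subtreeSum-siblings≤ nonzero e ec (c≢x ∘ sym) ⟩
    nnzSubtree p                 ≤⟨ nnzSubtree≤nnz p ⟩
    nnz z                        ∎
    where open ≤-Reasoning

  bound-via-grandparent : ∀ {x p q} → π x ≡ just p → π p ≡ just q → z q ≢ 0ℚ →
                          nnzSubtree x + β q ≤ nnzSubtree q + parentVal π β q + βb p
  bound-via-grandparent {x} {p} {q} e e′ zq≢0 = begin
    nnzSubtree x + β q
      ≡⟨ cong (nnzSubtree x +_) (trans (β-S q∈V q∈S) (cong (_+ parentVal π β q) (βb-S q∈V q∈S))) ⟩
    nnzSubtree x + (suc (childSumℕ βb q) + parentVal π β q)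
      ≡⟨ shuffle₁ (nnzSubtree x) (childSumℕ βb q) (parentVal π β q) ⟩
    suc (childSumℕ βb q + nnzSubtree x) + parentVal π β q
      ≤⟨ +-monoˡ-≤ (parentVal π β q) (s≤s children-bound) ⟩
    suc (childSumℕ nnzSubtree q + βb p) + parentVal π β q
      ≡⟨ shuffle₂ (childSumℕ nnzSubtree q) (βb p) (parentVal π β q) ⟩
    suc (childSumℕ nnzSubtree q) + parentVal π β q + βb p
      ≡⟨ cong (λ t → t + parentVal π β q + βb p) (nnzSubtree-unfold zq≢0) ⟨
    nnzSubtree q + parentVal π β q + βb p ∎
    where
    open ≤-Reasoning
    q∈S = support⊆S zq≢0
    q∈V = support⊆V zq≢0
    shuffle₁ : ∀ a s t → a + (suc s + t) ≡ suc (s + a) + t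
    shuffle₁ = solve-∀
    shuffle₂ : ∀ s b t → suc (s + b) + t ≡ suc s + t + b
    shuffle₂ = solve-∀
    children-bound : childSumℕ βb q + nnzSubtree x ≤ childSumℕ nnzSubtree q + βb p
    children-bound = childSumℕ-mono-except e′ (λ c _ ec → βb≤nnzSubtree-child ec zq≢0)
      (subst (βb p + nnzSubtree x ≤_) (+-comm (βb p) (nnzSubtree p))
             (+-monoʳ-≤ (βb p) (subtreeSum-child≤ nonzero e)))

  nnzSubtree+βparent≤nnz : ∀ x → z x ≢ 0ℚ → nnzSubtree x + parentVal π β x ≤ nnz z
  nnzSubtree+βparent≤nnz = depth-rec (λ x → z x ≢ 0ℚ → nnzSubtree x + parentVal π β x ≤ nnz z) step
    where
    step : ∀ x → (∀ {y} → depth y < depth x → z y ≢ 0ℚ → nnzSubtree y + parentVal π β y ≤ nnz z) →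
           z x ≢ 0ℚ → nnzSubtree x + parentVal π β x ≤ nnz z
    step x ih zx≢0 with root-or-parent x
    ... | inj₁ root = begin
      nnzSubtree x + parentVal π β x  ≡⟨ cong (nnzSubtree x +_) (parentVal-nothing β root) ⟩
      nnzSubtree x + 0                ≡⟨ +-identityʳ _ ⟩
      nnzSubtree x                    ≤⟨ nnzSubtree≤nnz x ⟩
      nnz z                           ∎
      where open ≤-Reasoning
    ... | inj₂ (p , e) with parent-of-support e zx≢0
    ...   | p∉S , q , e′ , βp≡ = begin
      nnzSubtree x + parentVal π β x        ≡⟨ cong (nnzSubtree x +_) (trans (parentVal-just β e) βp≡) ⟩
      nnzSubtree x + (βb p ⊓ (β q ∸ βb p))  ≤⟨ by-cases (z q ≟ℚ 0ℚ) ⟩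
      nnz z                                 ∎
      where
      open ≤-Reasoning
      by-cases : Dec (z q ≡ 0ℚ) → nnzSubtree x + (βb p ⊓ (β q ∸ βb p)) ≤ nnz z
      by-cases (yes zq≡0) =
        ≤-trans (+-monoʳ-≤ (nnzSubtree x) (m⊓n≤m _ _)) (bound-via-sibling e e′ p∉S zq≡0 zx≢0)
      by-cases (no zq≢0) =
        ≤-trans (+-monoʳ-≤ (nnzSubtree x) (m⊓n≤n _ _))
                (m+n≤o+p∧m≤o⇒m+[n∸p]≤o
                   (≤-trans (bound-via-grandparent e e′ zq≢0)
                            (+-monoˡ-≤ (βb p) (ih (<-trans (parent-depth< e′) (parent-depth< e)) zq≢0)))
                   (nnzSubtree≤nnz x))

lemma11 : (n : ℕ) (adj : Adj n) → IsForest adj →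
          (inS : Fin n → Bool) → IsSupportSet adj inS →
          (π : Fin n → Maybe (Fin n)) → IsRooting adj inS π →
          (βb β : Fin n → ℕ) → IsBetaBar adj inS π βb → IsBeta adj inS π βb β →
          ∀ x → inS x ≡ true → inV adj inS x ≡ true →
          ∀ (z : Fin n → ℚ) → InNullS adj inS z → ¬ z x ≡ 0ℚ →
          β x ≤ nnz z
lemma11 _ adj ((_ , adj-sym) , _) inS support π (parent-edge , edge-parent , root∈S , depth , depth-parent)
        βb β βb-rec β-rec x x∈S x∈V z z∈𝒩S zx≢0 = begin
  β x                             ≡⟨ β-S x∈V x∈S ⟩
  βb x + parentVal π β x          ≤⟨ +-monoˡ-≤ (parentVal π β x) (βb≤nnzSubtree x zx≢0) ⟩
  nnzSubtree x + parentVal π β x  ≤⟨ nnzSubtree+βparent≤nnz x zx≢0 ⟩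
  nnz z                           ∎
  where
  open ≤-Reasoning
  open Bounds adj adj-sym inS support π parent-edge edge-parent root∈S depth depth-parent
              βb β βb-rec β-rec z z∈𝒩S
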